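{- Let $k\geq 3$ and let $G_k$ be the graph defined below. Then (i) $\dim(G_k)=k$; (ii) the set $A$ is the unique metric basis of $G_k$; (iii) the set $\bigcup_{\emptyset\neq S\subseteq A}\{\{b_S,c_S\}\}$ is a pairing resolving set of $G_k$.
   Context: For $k\geq3$, $G_k$ is the graph with vertex set $A\cup B\cup C$, where $A,B,C$ are pairwise disjoint, $|A|=k$, and $B=\{b_S:\emptyset\neq S\subseteq A\}$, $C=\{c_S:\emptyset\neq S\subseteq A\}$ (so $|B|=|C|=2^k-1$). Edges: each of $A$, $B$, $C$ induces a clique; $b_S$ is adjacent to each vertex of $S$; $b_S$ is adjacent to $c_S$ for each nonempty $S\subseteq A$; there are no other edges. A set $W\subseteq V(G)$ is a resolving set if for all distinct $x,y$ there is $z\in W$ with $d(x,z)\neq d(y,z)$ ($d$ = shortest-path distance); $\dim(G)$ is the minimum size of a resolving set, and a metric basis is a resolving set of size $\dim(G)$. A set $\{\{u_1,w_1\},\ldots,\{u_m,w_m\}\}$ of $2$-subsets with $2m$ distinct elements in total is a pairing resolving set if every choice $\{x_1,\ldots,x_m\}$ with $x_i\in\{u_i,w_i\}$ is a resolving set. -}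

module Defs where

open import Data.Nat using (ℕ; zero; suc; _≤_)
open import Data.Bool using (Bool; true; false; T; if_then_else_)
open import Data.Fin using (Fin)
open import Data.Fin.Subset using (Subset; Nonempty; _∈_)
open import Data.Fin.Subset.Properties using (nonempty?)
open import Data.List using (List; length; map; allFin)
open import Data.List.Relation.Unary.Unique.Propositional using (Unique)
import Data.List.Membership.Propositional as LM
open import Data.Product using (Σ; ∃; ∃₂; _×_; _,_; proj₁)
open import Data.Empty using (⊥)
open import Relation.Nullary using (¬_)
open import Relation.Nullary.Decidable using (⌊_⌋)
open import Relation.Binary.PropositionalEquality using (_≡_; _≢_)
open import Function.Bundles using (_⇔_)

record Graph : Set₁ where
  field
    V   : Set
    Adj : V → V → Set
open Graph public

data Walk (G : Graph) : V G → V G → ℕ → Set where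
  here : ∀ {x} → Walk G x x zero
  step : ∀ {x y z n} → Adj G x y → Walk G y z n → Walk G x z (suc n)

Dist : (G : Graph) → V G → V G → ℕ → Set
Dist G x y n = Walk G x y n × (∀ m → Walk G x y m → n ≤ m)

IsResolving : (G : Graph) → (V G → Set) → Set
IsResolving G W =
  ∀ x y → x ≢ y →
    ∃ λ z → W z × ∃₂ λ m n → Dist G x z m × Dist G y z n × m ≢ n

-- A finite vertex set given as a duplicate-free list (size = length).
IsResolvingList : (G : Graph) → List (V G) → Set
IsResolvingList G L = Unique L × IsResolving G (λ v → LM._∈_ v L)

HasMetricDim : Graph → ℕ → Set
HasMetricDim G d =
  (∃ λ L → IsResolvingList G L × length L ≡ d) ×
  (∀ L → IsResolvingList G L → d ≤ length L)

IsMetricBasis : (G : Graph) → List (V G) → Set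
IsMetricBasis G L =
  IsResolvingList G L × (∀ L′ → IsResolvingList G L′ → length L ≤ length L′)

-- Pairing resolving set: pairs {u i, w i} indexed by I, with all 2m
-- elements distinct, such that every choice of one element per pair
-- gives a resolving set.
IsPairingResolving : (G : Graph) (I : Set) → (I → V G) → (I → V G) → Set
IsPairingResolving G I u w =
  (∀ i j → u i ≡ u j → i ≡ j) ×
  (∀ i j → w i ≡ w j → i ≡ j) ×
  (∀ i j → u i ≢ w j) ×
  (∀ (ch : I → Bool) →
     IsResolving G (λ v → ∃ λ i → v ≡ (if ch i then u i else w i)))

-- Nonempty subsets of A = Fin k (the proof component is T of a boolean,
-- hence proof-irrelevant).
NESubset : ℕ → Set
NESubset k = Σ (Subset k) (λ S → T ⌊ nonempty? S ⌋)

data Vtx (k : ℕ) : Set where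
  a : Fin k → Vtx k
  b : NESubset k → Vtx k
  c : NESubset k → Vtx k

AdjG : (k : ℕ) → Vtx k → Vtx k → Set
AdjG k (a i) (a j) = i ≢ j
AdjG k (b S) (b S′) = proj₁ S ≢ proj₁ S′
AdjG k (c S) (c S′) = proj₁ S ≢ proj₁ S′
AdjG k (a i) (b S) = i ∈ proj₁ S
AdjG k (b S) (a i) = i ∈ proj₁ S
AdjG k (b S) (c S′) = proj₁ S ≡ proj₁ S′
AdjG k (c S) (b S′) = proj₁ S ≡ proj₁ S′
AdjG k (a i) (c S) = ⊥
AdjG k (c S) (a i) = ⊥

G : ℕ → Graph
G k = record { V = Vtx k ; Adj = AdjG k }

Alist : (k : ℕ) → List (Vtx k)
Alist k = map a (allFin k)

module Submission where

-- Then: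
--  * A resolves G_k, and any x ≠ y is separated by both b_U and c_U for some
--    U, so every choice from the pairs {b_U, c_U} resolves G_k;
--  * twin lemma: c_S, c_T are separated only by a_r with r in S △ T or by
--    b_U, c_U with U ∈ {S, T}.  If a_i ∉ L for a resolving L, then L meets each
--    of the k disjoint pairs {A ∖ {i,j}, A ∖ {j} ∪ {i}} and one more vertex,
--    so |L| ≥ k + 1.  This gives dim(G_k) ≥ k and forces every basis to be A.

open import Defs
open import Data.Nat using (ℕ; zero; suc; _≤_; _≤ᵇ_; z≤n; s≤s)
open import Data.Nat.Properties using (≤ᵇ⇒≤; ≤-reflexive; ≤-trans; ≤-antisym; _≤?_; ≰⇒>; 1+n≰n; n≤1+n)
open import Data.Bool using (Bool; true; false; T; not; _∧_; _∨_; if_then_else_)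
import Data.Bool as Bool
open import Data.Bool.Properties using (T-irrelevant; ∨-zeroʳ; ∧-zeroʳ)
open import Data.Maybe using (Maybe; just; nothing)
import Data.Maybe.Properties as Maybe
open import Data.Fin using (Fin; zero; suc)
open import Data.Fin.Properties using (_≟_; pigeonhole; <⇒≢; ¬∀⟶∃¬)
import Data.Fin.Properties as Fin
open import Data.Fin.Subset using (Subset) renaming (_∈_ to _∈ₛ_)
open import Data.Vec using (lookup; tabulate)
open import Data.Vec.Properties using (≡-dec; lookup∘tabulate; tabulate∘lookup; tabulate-cong; []=⇒lookup; lookup⇒[]=)
import Data.Vec.Functional as Fun
open import Data.List using (List; length; allFin)
import Data.List as List
open import Data.List.Properties using (length-map; length-tabulate)
open import Data.List.Relation.Unary.Any using (index)
import Data.List.Relation.Unary.Any as Any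
open import Data.List.Relation.Unary.Any.Properties using (lookup-index)
open import Data.List.Relation.Unary.Unique.Propositional.Properties using (map⁺; allFin⁺)
open import Data.List.Membership.Propositional using (_∈_; _∉_; find; lose)
open import Data.List.Membership.Propositional.Properties using (∈-map⁺; ∈-map⁻; ∈-allFin)
open import Data.Product using (∃; _×_; _,_; proj₁; proj₂; map₂)
open import Data.Sum using (_⊎_; inj₁; inj₂; [_,_])
open import Data.Empty using (⊥; ⊥-elim)
open import Function using (_∘_)
open import Function.Bundles using (_⇔_; mk⇔)
open import Function.Definitions using (Injective)
open import Relation.Nullary using (¬_; Dec; does; yes; no; contradiction)
open import Relation.Nullary.Decidable using (dec-true; dec-false; map′; toWitness; fromWitness)
open import Relation.Binary.Definitions using (DecidableEquality)
open import Relation.Binary.PropositionalEquality using (_≡_; _≢_; refl; sym; trans; cong; cong₂; subst; module ≡-Reasoning)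

variable
  k m : ℕ
  A : Set

if-both : {P : A → Set} (β : Bool) {x y : A} → P x → P y → P (if β then x else y)
if-both true px _ = px
if-both false _ py = py

if-true : {β : Bool} {x y : A} → β ≡ true → (if β then x else y) ≡ x
if-true refl = refl

if-false : {β : Bool} {x y : A} → β ≡ false → (if β then x else y) ≡ y
if-false refl = refl

if-≢ : {β γ : Bool} {x y : A} → β ≢ γ → x ≢ y → (if β then x else y) ≢ (if γ then x else y)
if-≢ {β = true} {true} β≢γ _ = contradiction refl β≢γ
if-≢ {β = true} {false} _ x≢y = x≢y
if-≢ {β = false} {true} _ x≢y = x≢y ∘ sym
if-≢ {β = false} {false} β≢γ _ = contradiction refl β≢γ

≤-eval : {m n : ℕ} {_ : T (m ≤ᵇ n)} → m ≤ n
≤-eval {m} {n} {m≤ᵇn} = ≤ᵇ⇒≤ m n m≤ᵇn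

avoid-two : DecidableEquality A → (x y z : A) → x ≢ y → x ≢ z → y ≢ z →
            (s t : A) → ∃ λ u → u ≢ s × u ≢ t
avoid-two _≟ₐ_ x y z x≢y x≢z y≢z s t with x ≟ₐ s | x ≟ₐ t
... | no x≢s | no x≢t = x , x≢s , x≢t
... | yes refl | _ with y ≟ₐ t
...   | no y≢t = y , x≢y ∘ sym , y≢t
...   | yes refl = z , x≢z ∘ sym , y≢z ∘ sym
avoid-two _≟ₐ_ x y z x≢y x≢z y≢z s t | no x≢s | yes refl with y ≟ₐ s
...   | no y≢s = y , y≢s , x≢y ∘ sym
...   | yes refl = z , y≢z ∘ sym , x≢z ∘ sym

injection-length : (f : Fin m → A) → Injective _≡_ _≡_ f → (L : List A) →
                   (∀ x → f x ∈ L) → m ≤ length L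
injection-length {m} f f-inj L f∈L with m ≤? length L
... | yes m≤|L| = m≤|L|
... | no m≰|L| with pigeonhole (≰⇒> m≰|L|) (λ x → index (f∈L x))
...   | x , y , x<y , same-position = contradiction (f-inj fx≡fy) (<⇒≢ x<y)
  where
  open ≡-Reasoning
  fx≡fy : f x ≡ f y
  fx≡fy = begin
    f x                              ≡⟨ lookup-index (f∈L x) ⟩
    List.lookup L (index (f∈L x))    ≡⟨ cong (List.lookup L) same-position ⟩
    List.lookup L (index (f∈L y))    ≡⟨ sym (lookup-index (f∈L y)) ⟩
    f y                              ∎

count-with-extra : {L : List A} (C : Fin m → A → Set) →
                   (∀ {x y v} → x ≢ y → C x v → ¬ C y v) →
                   (∀ x → ∃ λ v → v ∈ L × C x v) →
                   (∃ λ e → e ∈ L × ∀ x → ¬ C x e) →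
                   suc m ≤ length L
count-with-extra {A = A} {m = m} {L = L} C apart member (e , e∈L , e∉C) =
  injection-length (e Fun.∷ f) injective L contained
  where
  f : Fin m → A
  f x = proj₁ (member x)
  f∈C : ∀ x → C x (f x)
  f∈C x = proj₂ (proj₂ (member x))
  disjoint : ∀ {x y v} → C x v → C y v → x ≡ y
  disjoint {x} {y} p q with x ≟ y
  ... | yes x≡y = x≡y
  ... | no x≢y = contradiction q (apart x≢y p)
  injective : Injective _≡_ _≡_ (e Fun.∷ f)
  injective {zero} {zero} _ = refl
  injective {zero} {suc y} e≡fy = contradiction (subst (C y) (sym e≡fy) (f∈C y)) (e∉C y)
  injective {suc x} {zero} fx≡e = contradiction (subst (C x) fx≡e (f∈C x)) (e∉C x)
  injective {suc x} {suc y} fx≡fy = cong suc (disjoint (subst (C x) fx≡fy (f∈C x)) (f∈C y))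
  contained : ∀ x → (e Fun.∷ f) x ∈ L
  contained zero = e∈L
  contained (suc x) = proj₁ (proj₂ (member x))

three-points : 3 ≤ k → ∃ λ (x : Fin k) → ∃ λ y → ∃ λ z → x ≢ y × x ≢ z × y ≢ z
three-points (s≤s (s≤s (s≤s _))) = zero , suc zero , suc (suc zero) , (λ ()) , (λ ()) , (λ ())

avoid-points : 3 ≤ k → (i j : Fin k) → ∃ λ r → r ≢ i × r ≢ j
avoid-points k≥3 i j =
  let x , y , z , x≢y , x≢z , y≢z = three-points k≥3 in avoid-two _≟_ x y z x≢y x≢z y≢z i j

_≡ᵇ_ : Fin k → Fin k → Bool
r ≡ᵇ i = does (r ≟ i)

≡ᵇ-refl : (i : Fin k) → (i ≡ᵇ i) ≡ true
≡ᵇ-refl i = dec-true (i ≟ i) refl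

≢⇒≡ᵇ-false : {r i : Fin k} → r ≢ i → (r ≡ᵇ i) ≡ false
≢⇒≡ᵇ-false {r = r} {i} = dec-false (r ≟ i)

_≟ₛ_ : DecidableEquality (Subset k)
_≟ₛ_ = ≡-dec Bool._≟_

elems : NESubset k → Subset k
elems = proj₁

_∋ᵇ_ : NESubset k → Fin k → Bool
S ∋ᵇ r = lookup (elems S) r

elems-injective : {S T : NESubset k} → elems S ≡ elems T → S ≡ T
elems-injective {S = s , p} {.s , q} refl = cong (s ,_) (T-irrelevant p q)

some-member : (S : NESubset k) → ∃ λ j → S ∋ᵇ j ≡ true
some-member (s , nonempty) = let j , j∈s = toWitness nonempty in j , []=⇒lookup j∈s

differ-at : {S T : NESubset k} (r : Fin k) → S ∋ᵇ r ≢ T ∋ᵇ r → elems S ≢ elems T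
differ-at r differ S≡T = differ (cong (λ s → lookup s r) S≡T)

true≢false : {β γ : Bool} → β ≡ true → γ ≡ false → β ≢ γ
true≢false β≡true γ≡false β≡γ = contradiction (trans (sym β≡true) (trans β≡γ γ≡false)) λ ()

∋-∌⇒≢ : {S T : NESubset k} {r : Fin k} → S ∋ᵇ r ≡ true → T ∋ᵇ r ≡ false → elems S ≢ elems T
∋-∌⇒≢ {S = S} {T} {r} r∈S r∉T = differ-at {S = S} {T} r (true≢false r∈S r∉T)

differ-somewhere : (s t : Subset k) → s ≢ t → ∃ λ r → lookup s r ≢ lookup t r
differ-somewhere {k} s t s≢t =
  ¬∀⟶∃¬ k (λ r → lookup s r ≡ lookup t r) (λ r → lookup s r Bool.≟ lookup t r) agree⇒equal
  where
  agree⇒equal : ¬ (∀ r → lookup s r ≡ lookup t r)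
  agree⇒equal agree = s≢t (trans (sym (tabulate∘lookup s))
                                 (trans (tabulate-cong agree) (tabulate∘lookup t)))

fromChar : (f : Fin k → Bool) (r : Fin k) → f r ≡ true → NESubset k
fromChar f r fr = tabulate f , fromWitness (r , lookup⇒[]= r (tabulate f) (trans (lookup∘tabulate f r) fr))

⁅_⁆ : Fin k → NESubset k
⁅ i ⁆ = fromChar (_≡ᵇ i) i (≡ᵇ-refl i)

⁅⁆-∋-self : (i : Fin k) → ⁅ i ⁆ ∋ᵇ i ≡ true
⁅⁆-∋-self i = trans (lookup∘tabulate (_≡ᵇ i) i) (≡ᵇ-refl i)

⁅⁆-∌-other : {i r : Fin k} → r ≢ i → ⁅ i ⁆ ∋ᵇ r ≡ false
⁅⁆-∌-other {i = i} {r} r≢i = trans (lookup∘tabulate (_≡ᵇ i) r) (≢⇒≡ᵇ-false r≢i)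

whole : Fin k → NESubset k
whole i = fromChar (λ _ → true) i refl

_≟ₙ_ : DecidableEquality (NESubset k)
S ≟ₙ T = map′ elems-injective (cong elems) (elems S ≟ₛ elems T)

-- For k ≥ 3, some subset containing i differs from a given S: {i} or A.
containing-avoiding : 3 ≤ k → (i : Fin k) (S : NESubset k) →
                      ∃ λ U → U ∋ᵇ i ≡ true × elems U ≢ elems S
containing-avoiding k≥3 i S with elems ⁅ i ⁆ ≟ₛ elems S
... | no ⁅i⁆≢S = ⁅ i ⁆ , ⁅⁆-∋-self i , ⁅i⁆≢S
... | yes ⁅i⁆≡S = whole i , lookup∘tabulate _ i , λ A≡S → A≢⁅i⁆ (trans A≡S (sym ⁅i⁆≡S))
  where
  r = proj₁ (avoid-points k≥3 i i)
  r≢i = proj₁ (proj₂ (avoid-points k≥3 i i))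
  A≢⁅i⁆ : elems (whole i) ≢ elems ⁅ i ⁆
  A≢⁅i⁆ = ∋-∌⇒≢ {S = whole i} {⁅ i ⁆} (lookup∘tabulate _ r) (⁅⁆-∌-other r≢i)

-- For k ≥ 3, some subset differs from two given ones (one of three singletons).
subset-avoiding : 3 ≤ k → (S T : NESubset k) → ∃ λ U → elems U ≢ elems S × elems U ≢ elems T
subset-avoiding k≥3 S T =
  let x , y , z , x≢y , x≢z , y≢z = three-points k≥3
      U , U≢S , U≢T = avoid-two _≟ₙ_ ⁅ x ⁆ ⁅ y ⁆ ⁅ z ⁆
                        (distinct x≢y) (distinct x≢z) (distinct y≢z) S T
  in U , U≢S ∘ elems-injective , U≢T ∘ elems-injective
  where
  distinct : {x y : Fin _} → x ≢ y → ⁅ x ⁆ ≢ ⁅ y ⁆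
  distinct {x} x≢y ⁅x⁆≡⁅y⁆ =
    ∋-∌⇒≢ {S = ⁅ x ⁆} {⁅ _ ⁆} (⁅⁆-∋-self x) (⁅⁆-∌-other x≢y) (cong elems ⁅x⁆≡⁅y⁆)

same : (s : Subset k) → does (s ≟ₛ s) ≡ true
same s = dec-true (s ≟ₛ s) refl

different : {s t : Subset k} → s ≢ t → does (s ≟ₛ t) ≡ false
different {s = s} {t} = dec-false (s ≟ₛ t)

member : (S : NESubset k) {i : Fin k} → S ∋ᵇ i ≡ true → i ∈ₛ elems S
member S {i} = lookup⇒[]= i (elems S)

outside≢inside : (S : NESubset k) {i j : Fin k} → S ∋ᵇ i ≡ false → S ∋ᵇ j ≡ true → i ≢ j
outside≢inside S i∉S j∈S refl = contradiction (trans (sym i∉S) j∈S) λ ()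

-- The distance table of G_k.  It is kept opaque: outside the block below it
-- is only accessed through the listed entries and the shortest-path property.
opaque

  dist : Vtx k → Vtx k → ℕ
  dist (a i) (a j) = if i ≡ᵇ j then 0 else 1
  dist (a i) (b S) = if S ∋ᵇ i then 1 else 2
  dist (a i) (c S) = if S ∋ᵇ i then 2 else 3
  dist (b S) (a i) = if S ∋ᵇ i then 1 else 2
  dist (b S) (b T) = if does (elems S ≟ₛ elems T) then 0 else 1
  dist (b S) (c T) = if does (elems S ≟ₛ elems T) then 1 else 2
  dist (c S) (a i) = if S ∋ᵇ i then 2 else 3
  dist (c S) (b T) = if does (elems S ≟ₛ elems T) then 1 else 2
  dist (c S) (c T) = if does (elems S ≟ₛ elems T) then 0 else 1

opaque
  unfolding dist

  dist-refl : (x : Vtx k) → dist x x ≡ 0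
  dist-refl (a i) = if-true (≡ᵇ-refl i)
  dist-refl (b S) = if-true (same (elems S))
  dist-refl (c S) = if-true (same (elems S))

  dist-zero : (x y : Vtx k) → dist x y ≡ 0 → x ≡ y
  dist-zero (a i) (a j) d with i ≟ j
  ... | yes refl = refl
  ... | no _ = contradiction d λ ()
  dist-zero (b S) (b T) d with elems S ≟ₛ elems T
  ... | yes S≡T = cong b (elems-injective S≡T)
  ... | no _ = contradiction d λ ()
  dist-zero (c S) (c T) d with elems S ≟ₛ elems T
  ... | yes S≡T = cong c (elems-injective S≡T)
  ... | no _ = contradiction d λ ()
  dist-zero (a i) (b S) d = contradiction d (if-both {P = _≢ 0} (S ∋ᵇ i) (λ ()) (λ ()))
  dist-zero (a i) (c S) d = contradiction d (if-both {P = _≢ 0} (S ∋ᵇ i) (λ ()) (λ ()))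
  dist-zero (b S) (a i) d = contradiction d (if-both {P = _≢ 0} (S ∋ᵇ i) (λ ()) (λ ()))
  dist-zero (b S) (c T) d = contradiction d (if-both {P = _≢ 0} (does (elems S ≟ₛ elems T)) (λ ()) (λ ()))
  dist-zero (c S) (a i) d = contradiction d (if-both {P = _≢ 0} (S ∋ᵇ i) (λ ()) (λ ()))
  dist-zero (c S) (b T) d = contradiction d (if-both {P = _≢ 0} (does (elems S ≟ₛ elems T)) (λ ()) (λ ()))

  dist-ab-∈ : {S : NESubset k} {i : Fin k} → S ∋ᵇ i ≡ true → dist (a i) (b S) ≡ 1
  dist-ab-∈ = if-true

  dist-ab-∉ : {S : NESubset k} {i : Fin k} → S ∋ᵇ i ≡ false → dist (a i) (b S) ≡ 2
  dist-ab-∉ = if-false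

  dist-ac-∈ : {S : NESubset k} {i : Fin k} → S ∋ᵇ i ≡ true → dist (a i) (c S) ≡ 2
  dist-ac-∈ = if-true

  dist-ac-∉ : {S : NESubset k} {i : Fin k} → S ∋ᵇ i ≡ false → dist (a i) (c S) ≡ 3
  dist-ac-∉ = if-false

  dist-ba-∈ : {S : NESubset k} {i : Fin k} → S ∋ᵇ i ≡ true → dist (b S) (a i) ≡ 1
  dist-ba-∈ = if-true

  dist-bb-≢ : {S T : NESubset k} → elems S ≢ elems T → dist (b S) (b T) ≡ 1
  dist-bb-≢ = if-false ∘ different

  dist-cc-≢ : {S T : NESubset k} → elems S ≢ elems T → dist (c S) (c T) ≡ 1
  dist-cc-≢ = if-false ∘ different

  dist-bc-≢ : {S T : NESubset k} → elems S ≢ elems T → dist (b S) (c T) ≡ 2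
  dist-bc-≢ = if-false ∘ different

  dist-cb-≢ : {S T : NESubset k} → elems S ≢ elems T → dist (c S) (b T) ≡ 2
  dist-cb-≢ = if-false ∘ different

  dist-bc-same : (S : NESubset k) → dist (b S) (c S) ≡ 1
  dist-bc-same S = if-true (same (elems S))

  dist-cb-same : (S : NESubset k) → dist (c S) (b S) ≡ 1
  dist-cb-same S = if-true (same (elems S))

  dist-ac≢1 : {S : NESubset k} {i : Fin k} → dist (a i) (c S) ≢ 1
  dist-ac≢1 {S = S} {i} = if-both {P = _≢ 1} (S ∋ᵇ i) (λ ()) (λ ())

  dist-ca≢1 : {S : NESubset k} {i : Fin k} → dist (c S) (a i) ≢ 1
  dist-ca≢1 {S = S} {i} = if-both {P = _≢ 1} (S ∋ᵇ i) (λ ()) (λ ())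

  dist-ba-differ : {S T : NESubset k} {r : Fin k} → S ∋ᵇ r ≢ T ∋ᵇ r → dist (b S) (a r) ≢ dist (b T) (a r)
  dist-ba-differ differ = if-≢ differ (λ ())

  dist-ca-differ : {S T : NESubset k} {r : Fin k} → S ∋ᵇ r ≢ T ∋ᵇ r → dist (c S) (a r) ≢ dist (c T) (a r)
  dist-ca-differ differ = if-≢ differ (λ ())

  dist-ca-agree : {S T : NESubset k} {r : Fin k} → S ∋ᵇ r ≡ T ∋ᵇ r → dist (c S) (a r) ≡ dist (c T) (a r)
  dist-ca-agree = cong (λ β → if β then 2 else 3)

  dist≤3 : (x y : Vtx k) → dist x y ≤ 3
  dist≤3 (a i) (a j) = if-both {P = _≤ 3} (i ≡ᵇ j) ≤-eval ≤-eval
  dist≤3 (a i) (b S) = if-both {P = _≤ 3} (S ∋ᵇ i) ≤-eval ≤-eval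
  dist≤3 (a i) (c S) = if-both {P = _≤ 3} (S ∋ᵇ i) ≤-eval ≤-eval
  dist≤3 (b S) (a i) = if-both {P = _≤ 3} (S ∋ᵇ i) ≤-eval ≤-eval
  dist≤3 (b S) (b T) = if-both {P = _≤ 3} (does (elems S ≟ₛ elems T)) ≤-eval ≤-eval
  dist≤3 (b S) (c T) = if-both {P = _≤ 3} (does (elems S ≟ₛ elems T)) ≤-eval ≤-eval
  dist≤3 (c S) (a i) = if-both {P = _≤ 3} (S ∋ᵇ i) ≤-eval ≤-eval
  dist≤3 (c S) (b T) = if-both {P = _≤ 3} (does (elems S ≟ₛ elems T)) ≤-eval ≤-eval
  dist≤3 (c S) (c T) = if-both {P = _≤ 3} (does (elems S ≟ₛ elems T)) ≤-eval ≤-eval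

  adjacent-dist : (x y : Vtx k) → AdjG k x y → dist x y ≤ 1
  adjacent-dist (a i) (a j) _ = if-both {P = _≤ 1} (i ≡ᵇ j) ≤-eval ≤-eval
  adjacent-dist (a i) (b S) i∈S = ≤-reflexive (if-true ([]=⇒lookup i∈S))
  adjacent-dist (b S) (a i) i∈S = ≤-reflexive (if-true ([]=⇒lookup i∈S))
  adjacent-dist (b S) (b T) _ = if-both {P = _≤ 1} (does (elems S ≟ₛ elems T)) ≤-eval ≤-eval
  adjacent-dist (b S) (c T) S≡T = ≤-reflexive (if-true (dec-true (elems S ≟ₛ elems T) S≡T))
  adjacent-dist (c S) (b T) S≡T = ≤-reflexive (if-true (dec-true (elems S ≟ₛ elems T) S≡T))
  adjacent-dist (c S) (c T) _ = if-both {P = _≤ 1} (does (elems S ≟ₛ elems T)) ≤-eval ≤-eval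

  -- Vertices joined by a path of length 2 are at table distance at most 2:
  -- the pairs a_i, c_S at distance 3 (i ∉ S) have no common neighbour.
  two-steps : (x y z : Vtx k) → AdjG k x y → AdjG k y z → dist x z ≤ 2
  two-steps (a i) (b S) (c T) i∈S S≡T =
    ≤-reflexive (if-true (trans (cong (λ s → lookup s i) (sym S≡T)) ([]=⇒lookup i∈S)))
  two-steps (c S) (b T) (a i) S≡T i∈T =
    ≤-reflexive (if-true (trans (cong (λ s → lookup s i) S≡T) ([]=⇒lookup i∈T)))
  two-steps (a i) (a j) (c T) _ ()
  two-steps (c S) (c T) (a i) _ ()
  two-steps (a i) _ (a j) _ _ = if-both {P = _≤ 2} (i ≡ᵇ j) ≤-eval ≤-eval
  two-steps (a i) _ (b S) _ _ = if-both {P = _≤ 2} (S ∋ᵇ i) ≤-eval ≤-eval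
  two-steps (b S) _ (a i) _ _ = if-both {P = _≤ 2} (S ∋ᵇ i) ≤-eval ≤-eval
  two-steps (b S) _ (b T) _ _ = if-both {P = _≤ 2} (does (elems S ≟ₛ elems T)) ≤-eval ≤-eval
  two-steps (b S) _ (c T) _ _ = if-both {P = _≤ 2} (does (elems S ≟ₛ elems T)) ≤-eval ≤-eval
  two-steps (c S) _ (b T) _ _ = if-both {P = _≤ 2} (does (elems S ≟ₛ elems T)) ≤-eval ≤-eval
  two-steps (c S) _ (c T) _ _ = if-both {P = _≤ 2} (does (elems S ≟ₛ elems T)) ≤-eval ≤-eval

  -- Conversely the table distance is attained by a walk.  A point i ∉ S
  -- reaches b_S through a point of S, and b_S, c_T with S ≠ T are linked
  -- through b_T (or c_S).
  geodesic : (x y : Vtx k) → Walk (G k) x y (dist x y)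
  geodesic (a i) (a j) with i ≟ j
  ... | yes refl = here
  ... | no i≢j = step i≢j here
  geodesic (a i) (b S) with S ∋ᵇ i in i∈S
  ... | true = step (member S i∈S) here
  ... | false = let j , j∈S = some-member S in
    step {y = a j} (outside≢inside S i∈S j∈S) (step (member S j∈S) here)
  geodesic (a i) (c S) with S ∋ᵇ i in i∈S
  ... | true = step {y = b S} (member S i∈S) (step refl here)
  ... | false = let j , j∈S = some-member S in
    step {y = a j} (outside≢inside S i∈S j∈S) (step {y = b S} (member S j∈S) (step refl here))
  geodesic (b S) (a i) with S ∋ᵇ i in i∈S
  ... | true = step (member S i∈S) here
  ... | false = let j , j∈S = some-member S in
    step {y = a j} (member S j∈S) (step (outside≢inside S i∈S j∈S ∘ sym) here)
  geodesic (c S) (a i) with S ∋ᵇ i in i∈S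
  ... | true = step {y = b S} refl (step (member S i∈S) here)
  ... | false = let j , j∈S = some-member S in
    step {y = b S} refl (step {y = a j} (member S j∈S) (step (outside≢inside S i∈S j∈S ∘ sym) here))
  geodesic (b S) (b T) with elems S ≟ₛ elems T
  ... | yes S≡T = subst (λ U → Walk (G _) (b S) (b U) 0) (elems-injective S≡T) here
  ... | no S≢T = step S≢T here
  geodesic (c S) (c T) with elems S ≟ₛ elems T
  ... | yes S≡T = subst (λ U → Walk (G _) (c S) (c U) 0) (elems-injective S≡T) here
  ... | no S≢T = step S≢T here
  geodesic (b S) (c T) with elems S ≟ₛ elems T
  ... | yes S≡T = step S≡T here
  ... | no S≢T = step {y = b T} S≢T (step refl here)
  geodesic (c S) (b T) with elems S ≟ₛ elems T
  ... | yes S≡T = step S≡T here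
  ... | no S≢T = step {y = c T} S≢T (step refl here)

walk-length≥dist : {x y : Vtx k} {n : ℕ} → Walk (G k) x y n → dist x y ≤ n
walk-length≥dist {x = x} here = ≤-reflexive (dist-refl x)
walk-length≥dist {x = x} {y} (step xy here) = adjacent-dist x y xy
walk-length≥dist {x = x} {z} (step {y = y} xy (step yz here)) = two-steps x y z xy yz
walk-length≥dist {x = x} {y} (step _ (step _ (step _ _))) = ≤-trans (dist≤3 x y) (s≤s (s≤s (s≤s z≤n)))

dist-spec : (x y : Vtx k) → Dist (G k) x y (dist x y)
dist-spec x y = geodesic x y , λ _ → walk-length≥dist

dist-unique : {x y : Vtx k} {n : ℕ} → Dist (G k) x y n → n ≡ dist x y
dist-unique {x = x} {y} (walk , shortest) = ≤-antisym (shortest _ (geodesic x y)) (walk-length≥dist walk)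

Separates : Vtx k → Vtx k → Vtx k → Set
Separates z x y = dist x z ≢ dist y z

resolving-by-dist : {W : Vtx k → Set} → (∀ x y → x ≢ y → ∃ λ z → W z × Separates z x y) →
                    IsResolving (G k) W
resolving-by-dist separate x y x≢y =
  let z , z∈W , sep = separate x y x≢y in
  z , z∈W , dist x z , dist y z , dist-spec x z , dist-spec y z , sep

separator : {W : Vtx k → Set} → IsResolving (G k) W → {x y : Vtx k} → x ≢ y →
            ∃ λ z → W z × Separates z x y
separator resolving x≢y with resolving _ _ x≢y
... | z , z∈W , m , n , dx , dy , m≢n =
  z , z∈W , λ same-dist → m≢n (trans (dist-unique dx) (trans same-dist (sym (dist-unique dy))))

separates : {x y z : Vtx k} {m n : ℕ} → dist x z ≡ m → dist y z ≡ n → m ≢ n → Separates z x y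
separates refl refl m≢n = m≢n

sep-sym : {x y z : Vtx k} → Separates z x y → Separates z y x
sep-sym = _∘ sym

self-separates : (x y : Vtx k) → x ≢ y → Separates x x y
self-separates x y x≢y same-dist = x≢y (sym (dist-zero y x (trans (sym same-dist) (dist-refl x))))

a-injective : {i j : Fin k} → a i ≡ a j → i ≡ j
a-injective refl = refl

b-injective : {S T : NESubset k} → b S ≡ b T → S ≡ T
b-injective refl = refl

c-injective : {S T : NESubset k} → c S ≡ c T → S ≡ T
c-injective refl = refl

b-distinct : {S T : NESubset k} → b S ≢ b T → elems S ≢ elems T
b-distinct b≢b = b≢b ∘ cong b ∘ elems-injective

c-distinct : {S T : NESubset k} → c S ≢ c T → elems S ≢ elems T
c-distinct c≢c = c≢c ∘ cong c ∘ elems-injective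

-- A resolves G_k: distinct subsets differ at some a_r, and b_S, c_T are told
-- apart by any a_j with j ∈ S (distances 1 versus 2 or 3).
A-separates : (x y : Vtx k) → x ≢ y → ∃ λ i → Separates (a i) x y
A-separates (a i) y x≢y = i , self-separates (a i) y x≢y
A-separates x (a i) x≢y = i , sep-sym (self-separates (a i) x (x≢y ∘ sym))
A-separates (b S) (b T) b≢b =
  let r , differ = differ-somewhere _ _ (b-distinct b≢b) in r , dist-ba-differ differ
A-separates (c S) (c T) c≢c =
  let r , differ = differ-somewhere _ _ (c-distinct c≢c) in r , dist-ca-differ differ
A-separates (b S) (c T) _ =
  let j , j∈S = some-member S in j , λ same-dist → dist-ca≢1 (trans (sym same-dist) (dist-ba-∈ j∈S))
A-separates (c S) (b T) _ =
  let j , j∈T = some-member T in j , λ same-dist → dist-ca≢1 (trans same-dist (dist-ba-∈ j∈T))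

length-Alist : length (Alist k) ≡ k
length-Alist {k} = trans (length-map a (allFin k)) (length-tabulate (λ i → i))

A-resolving : IsResolvingList (G k) (Alist k)
A-resolving {k} = map⁺ a-injective (allFin⁺ k) , resolving-by-dist λ x y x≢y →
  let i , sep = A-separates x y x≢y in a i , ∈-map⁺ a (∈-allFin i) , sep

StronglySeparates : NESubset k → Vtx k → Vtx k → Set
StronglySeparates U x y = Separates (b U) x y × Separates (c U) x y

strong-sym : {U : NESubset k} {x y : Vtx k} → StronglySeparates U x y → StronglySeparates U y x
strong-sym (sb , sc) = sep-sym sb , sep-sym sc

-- {i} separates a_i and a_j: distances 1, 2 to b_{i} and 2, 3 to c_{i}.
strong-aa : (i j : Fin k) → j ≢ i → StronglySeparates ⁅ i ⁆ (a i) (a j)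
strong-aa i j j≢i =
  separates (dist-ab-∈ (⁅⁆-∋-self i)) (dist-ab-∉ (⁅⁆-∌-other j≢i)) (λ ()) ,
  separates (dist-ac-∈ (⁅⁆-∋-self i)) (dist-ac-∉ (⁅⁆-∌-other j≢i)) (λ ())

-- S separates a_i and b_S: b_S is the vertex itself, and d(a_i, c_S) ≥ 2.
strong-ab : (i : Fin k) (S : NESubset k) → StronglySeparates S (a i) (b S)
strong-ab i S =
  sep-sym (self-separates (b S) (a i) λ ()) ,
  λ same-dist → dist-ac≢1 (trans same-dist (dist-bc-same S))

-- A subset U ∋ i other than S separates a_i and c_S: distances 1, 2 to b_U
-- and 2, 1 to c_U.
strong-ac : 3 ≤ k → (i : Fin k) (S : NESubset k) → ∃ λ U → StronglySeparates U (a i) (c S)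
strong-ac k≥3 i S =
  let U , i∈U , U≢S = containing-avoiding k≥3 i S in
  U , separates (dist-ab-∈ i∈U) (dist-cb-≢ (U≢S ∘ sym)) (λ ())
    , separates (dist-ac-∈ i∈U) (dist-cc-≢ (U≢S ∘ sym)) (λ ())

-- S separates b_S from b_T (itself; and distances 1, 2 to c_S); similarly for c_S, c_T.
strong-bb : {S T : NESubset k} → elems S ≢ elems T → StronglySeparates S (b S) (b T)
strong-bb {S = S} {T} S≢T =
  self-separates (b S) (b T) (S≢T ∘ cong elems ∘ b-injective) ,
  separates (dist-bc-same S) (dist-bc-≢ (S≢T ∘ sym)) (λ ())

strong-cc : {S T : NESubset k} → elems S ≢ elems T → StronglySeparates S (c S) (c T)
strong-cc {S = S} {T} S≢T =
  separates (dist-cb-same S) (dist-cb-≢ (S≢T ∘ sym)) (λ ()) ,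
  self-separates (c S) (c T) (S≢T ∘ cong elems ∘ c-injective)

-- Any U ∉ {S, T} separates b_S and c_T: distances 1, 2 to b_U and 2, 1 to c_U.
strong-bc : 3 ≤ k → (S T : NESubset k) → ∃ λ U → StronglySeparates U (b S) (c T)
strong-bc k≥3 S T =
  let U , U≢S , U≢T = subset-avoiding k≥3 S T in
  U , separates (dist-bb-≢ (U≢S ∘ sym)) (dist-cb-≢ (U≢T ∘ sym)) (λ ())
    , separates (dist-bc-≢ (U≢S ∘ sym)) (dist-cc-≢ (U≢T ∘ sym)) (λ ())

strongly-separated : 3 ≤ k → (x y : Vtx k) → x ≢ y → ∃ λ U → StronglySeparates U x y
strongly-separated _ (a i) (a j) a≢a = ⁅ i ⁆ , strong-aa i j (a≢a ∘ cong a ∘ sym)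
strongly-separated _ (a i) (b S) _ = S , strong-ab i S
strongly-separated k≥3 (a i) (c S) _ = strong-ac k≥3 i S
strongly-separated _ (b S) (b T) b≢b = S , strong-bb (b-distinct b≢b)
strongly-separated _ (c S) (c T) c≢c = S , strong-cc (c-distinct c≢c)
strongly-separated k≥3 (b S) (c T) _ = strong-bc k≥3 S T
strongly-separated _ (b S) (a i) _ = S , strong-sym (strong-ab i S)
strongly-separated k≥3 (c S) (a i) _ = map₂ strong-sym (strong-ac k≥3 i S)
strongly-separated k≥3 (c S) (b T) _ = map₂ strong-sym (strong-bc k≥3 T S)

pairing-resolving : 3 ≤ k → IsPairingResolving (G k) (NESubset k) b c
pairing-resolving k≥3 =
  (λ _ _ → b-injective) , (λ _ _ → c-injective) , (λ _ _ ()) , λ choose →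
  resolving-by-dist λ x y x≢y →
    let U , sb , sc = strongly-separated k≥3 x y x≢y in
    (if choose U then b U else c U) , (U , refl) ,
    if-both {P = λ z → Separates z x y} (choose U) sb sc

label : Vtx k → Maybe (Subset k)
label (a _) = nothing
label (b S) = just (elems S)
label (c S) = just (elems S)

same-label : {v : Vtx k} {s t : Subset k} → label v ≡ just s → label v ≡ just t → s ≡ t
same-label v↦s v↦t = Maybe.just-injective (trans (sym v↦s) v↦t)

Meets : List (Vtx k) → Subset k → Set
Meets L s = ∃ λ v → v ∈ L × label v ≡ just s

meets? : (L : List (Vtx k)) (s : Subset k) → Dec (Meets L s)
meets? L s = map′ find (λ (v , v∈L , v↦s) → lose v∈L v↦s)
                  (Any.any? (λ v → Maybe.≡-dec _≟ₛ_ (label v) (just s)) L)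

a-member? : (j : Fin k) (L : List (Vtx k)) → Dec (a j ∈ L)
a-member? {k} j = Any.any? is-a-j
  where
  is-a-j : (v : Vtx k) → Dec (a j ≡ v)
  is-a-j (a l) = map′ (cong a) a-injective (j ≟ l)
  is-a-j (b _) = no λ ()
  is-a-j (c _) = no λ ()

equal-to-one : (s t u : Subset k) → (s ≢ u → t ≢ u → ⊥) → just u ≡ just s ⊎ just u ≡ just t
equal-to-one s t u neither with s ≟ₛ u | t ≟ₛ u
... | yes refl | _ = inj₁ refl
... | no _ | yes refl = inj₂ refl
... | no s≢u | no t≢u = ⊥-elim (neither s≢u t≢u)

-- Twin lemma: c_S and c_T are equidistant from a_r unless r lies in exactly
-- one of S, T, and from b_U, c_U unless U ∈ {S, T}.
twins-force : {L : List (Vtx k)} → IsResolving (G k) (_∈ L) → (S T : NESubset k) →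
              elems S ≢ elems T → (∀ r → S ∋ᵇ r ≢ T ∋ᵇ r → a r ∉ L) →
              ∃ λ v → v ∈ L × (label v ≡ just (elems S) ⊎ label v ≡ just (elems T))
twins-force resolving S T S≢T outside with separator resolving {c S} {c T} (S≢T ∘ cong elems ∘ c-injective)
... | a r , ar∈L , sep with S ∋ᵇ r Bool.≟ T ∋ᵇ r
...   | yes agree = contradiction (dist-ca-agree agree) sep
...   | no differ = contradiction ar∈L (outside r differ)
twins-force resolving S T S≢T outside | b U , bU∈L , sep =
  b U , bU∈L , equal-to-one _ _ _ λ S≢U T≢U → sep (trans (dist-cb-≢ S≢U) (sym (dist-cb-≢ T≢U)))
twins-force resolving S T S≢T outside | c U , cU∈L , sep =
  c U , cU∈L , equal-to-one _ _ _ λ S≢U T≢U → sep (trans (dist-cc-≢ S≢U) (sym (dist-cc-≢ T≢U)))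

-- The k pairs {S_j, T_j} with S_j = A ∖ {i, j} and T_j = S_j ∪ {i}, for a
-- fixed point i.  Each pair differs only at i, and the 2k subsets are distinct.
module Pairs (k≥3 : 3 ≤ k) (i : Fin k) where

  lowerChar upperChar : Fin k → Fin k → Bool
  lowerChar j r = not (r ≡ᵇ i) ∧ not (r ≡ᵇ j)
  upperChar j r = (r ≡ᵇ i) ∨ not (r ≡ᵇ j)

  lowerChar-true : {j r : Fin k} → r ≢ i → r ≢ j → lowerChar j r ≡ true
  lowerChar-true r≢i r≢j = cong₂ (λ β γ → not β ∧ not γ) (≢⇒≡ᵇ-false r≢i) (≢⇒≡ᵇ-false r≢j)

  -- S_j is nonempty thanks to a third point r ∉ {i, j}; T_j contains i.
  lower upper : Fin k → NESubset k
  lower j = let r , r≢i , r≢j = avoid-points k≥3 i j in fromChar (lowerChar j) r (lowerChar-true r≢i r≢j)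
  upper j = fromChar (upperChar j) i (cong (_∨ not (i ≡ᵇ j)) (≡ᵇ-refl i))

  lower-∌i : (j : Fin k) → lower j ∋ᵇ i ≡ false
  lower-∌i j = trans (lookup∘tabulate (lowerChar j) i) (cong (λ β → not β ∧ not (i ≡ᵇ j)) (≡ᵇ-refl i))

  upper-∋i : (j : Fin k) → upper j ∋ᵇ i ≡ true
  upper-∋i j = trans (lookup∘tabulate (upperChar j) i) (cong (_∨ not (i ≡ᵇ j)) (≡ᵇ-refl i))

  lower-∋ : {j r : Fin k} → r ≢ i → r ≢ j → lower j ∋ᵇ r ≡ true
  lower-∋ {j} {r} r≢i r≢j = trans (lookup∘tabulate (lowerChar j) r) (lowerChar-true r≢i r≢j)

  lower-∌self : (j : Fin k) → lower j ∋ᵇ j ≡ false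
  lower-∌self j = trans (lookup∘tabulate (lowerChar j) j)
                        (trans (cong (λ β → not (j ≡ᵇ i) ∧ not β) (≡ᵇ-refl j)) (∧-zeroʳ (not (j ≡ᵇ i))))

  upper-∋ : {j r : Fin k} → r ≢ j → upper j ∋ᵇ r ≡ true
  upper-∋ {j} {r} r≢j = trans (lookup∘tabulate (upperChar j) r)
                              (trans (cong (λ β → (r ≡ᵇ i) ∨ not β) (≢⇒≡ᵇ-false r≢j)) (∨-zeroʳ (r ≡ᵇ i)))

  -- Away from i, S_j and T_j agree (both are "r ≠ j").
  lower≈upper : {j r : Fin k} → r ≢ i → lower j ∋ᵇ r ≡ upper j ∋ᵇ r
  lower≈upper {j} {r} r≢i = begin
    lower j ∋ᵇ r                   ≡⟨ lookup∘tabulate (lowerChar j) r ⟩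
    not (r ≡ᵇ i) ∧ not (r ≡ᵇ j)    ≡⟨ cong (λ β → not β ∧ not (r ≡ᵇ j)) (≢⇒≡ᵇ-false r≢i) ⟩
    not (r ≡ᵇ j)                   ≡⟨ cong (λ β → β ∨ not (r ≡ᵇ j)) (≢⇒≡ᵇ-false r≢i) ⟨
    (r ≡ᵇ i) ∨ not (r ≡ᵇ j)        ≡⟨ lookup∘tabulate (upperChar j) r ⟨
    upper j ∋ᵇ r                   ∎
    where open ≡-Reasoning

  lower≢upper : (j l : Fin k) → elems (lower j) ≢ elems (upper l)
  lower≢upper j l = ∋-∌⇒≢ {S = upper l} {lower j} (upper-∋i l) (lower-∌i j) ∘ sym

  lower-separated : {j l : Fin k} → j ≢ l → ∃ λ r → r ≢ i × lower j ∋ᵇ r ≢ lower l ∋ᵇ r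
  lower-separated {j} {l} j≢l with l ≟ i
  ... | no l≢i = l , l≢i , true≢false (lower-∋ l≢i (j≢l ∘ sym)) (lower-∌self l)
  ... | yes refl = j , j≢l , true≢false (lower-∋ j≢l j≢l) (lower-∌self j) ∘ sym

  lower-injective : {j l : Fin k} → j ≢ l → elems (lower j) ≢ elems (lower l)
  lower-injective {j} {l} j≢l =
    let r , _ , differ = lower-separated j≢l in differ-at {S = lower j} {lower l} r differ

  upper-injective : {j l : Fin k} → j ≢ l → elems (upper j) ≢ elems (upper l)
  upper-injective {j} {l} j≢l =
    let r , r≢i , differ = lower-separated j≢l in
    differ-at {S = upper j} {upper l} r λ same-elems →
      differ (trans (lower≈upper r≢i) (trans same-elems (sym (lower≈upper r≢i))))

  ⁅i⁆≢lower : (j : Fin k) → elems ⁅ i ⁆ ≢ elems (lower j)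
  ⁅i⁆≢lower j = ∋-∌⇒≢ {S = ⁅ i ⁆} {lower j} (⁅⁆-∋-self i) (lower-∌i j)

  ⁅i⁆≢upper : (j : Fin k) → elems ⁅ i ⁆ ≢ elems (upper j)
  ⁅i⁆≢upper j =
    let r , r≢i , r≢j = avoid-points k≥3 i j in
    ∋-∌⇒≢ {S = upper j} {⁅ i ⁆} (upper-∋ r≢j) (⁅⁆-∌-other r≢i) ∘ sym

  InPair : Fin k → Vtx k → Set
  InPair j v = label v ≡ just (elems (lower j)) ⊎ label v ≡ just (elems (upper j))

  pairs-apart : {j l : Fin k} {v : Vtx k} → j ≢ l → InPair j v → ¬ InPair l v
  pairs-apart j≢l (inj₁ p) (inj₁ q) = lower-injective j≢l (same-label p q)
  pairs-apart {j} {l} j≢l (inj₁ p) (inj₂ q) = lower≢upper j l (same-label p q)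
  pairs-apart {j} {l} j≢l (inj₂ p) (inj₁ q) = lower≢upper l j (same-label q p)
  pairs-apart j≢l (inj₂ p) (inj₂ q) = upper-injective j≢l (same-label p q)

  pair-met : {L : List (Vtx k)} → IsResolving (G k) (_∈ L) → a i ∉ L →
             (j : Fin k) → ∃ λ v → v ∈ L × InPair j v
  pair-met {L} resolving ai∉L j = twins-force resolving (lower j) (upper j) (lower≢upper j j) only-at-i
    where
    only-at-i : ∀ r → lower j ∋ᵇ r ≢ upper j ∋ᵇ r → a r ∉ L
    only-at-i r differ with r ≟ i
    ... | yes refl = ai∉L
    ... | no r≢i = contradiction (lower≈upper r≢i) differ

  -- A resolving set missing a_i has at least k + 1 vertices: one in each pair,
  -- plus either some a_j, or a vertex labelled {i}, or (if neither exists,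
  -- so that every subset other than {i} is met) the sets S_j and T_i.
  missing-A-vertex : {L : List (Vtx k)} → IsResolving (G k) (_∈ L) → a i ∉ L → suc k ≤ length L
  missing-A-vertex {L} resolving ai∉L with Fin.any? (λ j → a-member? j L)
  ... | yes (j , aj∈L) =
    count-with-extra InPair pairs-apart (pair-met resolving ai∉L)
      (a j , aj∈L , λ _ → [ (λ ()) , (λ ()) ])
  ... | no no-A-vertex with meets? L (elems ⁅ i ⁆)
  ...   | yes (v , v∈L , v↦⁅i⁆) =
    count-with-extra InPair pairs-apart (pair-met resolving ai∉L)
      (v , v∈L , λ j → [ ⁅i⁆≢lower j ∘ same-label v↦⁅i⁆ , ⁅i⁆≢upper j ∘ same-label v↦⁅i⁆ ])
  ...   | no ⁅i⁆-unmet =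
    let w , w∈L , w↦T = met (upper i) (⁅i⁆≢upper i ∘ sym) in
    count-with-extra (λ j v → label v ≡ just (elems (lower j)))
      (λ j≢l p q → lower-injective j≢l (same-label p q))
      (λ j → met (lower j) (⁅i⁆≢lower j ∘ sym))
      (w , w∈L , λ j w↦S → lower≢upper j i (same-label w↦S w↦T))
    where
    met : (X : NESubset k) → elems X ≢ elems ⁅ i ⁆ → ∃ λ v → v ∈ L × label v ≡ just (elems X)
    met X X≢⁅i⁆ with twins-force resolving X ⁅ i ⁆ X≢⁅i⁆ (λ r _ ar∈L → no-A-vertex (r , ar∈L))
    ... | v , v∈L , inj₁ v↦X = v , v∈L , v↦X
    ... | v , v∈L , inj₂ v↦⁅i⁆ = contradiction (v , v∈L , v↦⁅i⁆) ⁅i⁆-unmet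

open Pairs using (missing-A-vertex)

-- Every resolving set has at least k vertices: either it contains all of A,
-- or it misses some a_i and then has at least k + 1.
resolving-size : {L : List (Vtx k)} → 3 ≤ k → IsResolving (G k) (_∈ L) → k ≤ length L
resolving-size {k} {L} k≥3 resolving with Fin.all? (λ j → a-member? j L)
... | yes A⊆L = injection-length a a-injective L A⊆L
... | no A⊈L =
  let i , ai∉L = ¬∀⟶∃¬ k _ (λ j → a-member? j L) A⊈L in
  ≤-trans (n≤1+n k) (missing-A-vertex k≥3 i resolving ai∉L)

-- A metric basis L (so |L| ≤ k) contains every a_j, since otherwise
-- |L| ≥ k + 1, and nothing else, since A plus one more vertex has k + 1 elements.
basis-is-A : {L : List (Vtx k)} → 3 ≤ k → IsMetricBasis (G k) L → ∀ v → v ∈ L ⇔ v ∈ Alist k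
basis-is-A {k} {L} k≥3 ((_ , resolving) , minimal) v = mk⇔ (within-A v) from-A
  where
  not-too-big : ¬ (suc k ≤ length L)
  not-too-big big = 1+n≰n (≤-trans big (subst (length L ≤_) length-Alist (minimal (Alist k) A-resolving)))

  A⊆L : ∀ j → a j ∈ L
  A⊆L j with a-member? j L
  ... | yes aj∈L = aj∈L
  ... | no aj∉L = contradiction (missing-A-vertex k≥3 j resolving aj∉L) not-too-big

  beyond-A : ∀ w → w ∈ L → (∀ j → w ≢ a j) → ⊥
  beyond-A w w∈L w∉A = not-too-big
    (count-with-extra (λ j u → u ≡ a j) (λ j≢l p q → j≢l (a-injective (trans (sym p) q)))
                      (λ j → a j , A⊆L j , refl) (w , w∈L , w∉A))

  within-A : ∀ w → w ∈ L → w ∈ Alist k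
  within-A (a j) _ = ∈-map⁺ a (∈-allFin j)
  within-A (b S) bS∈L = ⊥-elim (beyond-A (b S) bS∈L λ _ ())
  within-A (c S) cS∈L = ⊥-elim (beyond-A (c S) cS∈L λ _ ())

  from-A : v ∈ Alist k → v ∈ L
  from-A v∈A = let j , _ , v≡aj = ∈-map⁻ a v∈A in subst (_∈ L) (sym v≡aj) (A⊆L j)

metric-dimension : 3 ≤ k → HasMetricDim (G k) k
metric-dimension k≥3 = (Alist _ , A-resolving , length-Alist) , λ _ (_ , resolving) → resolving-size k≥3 resolving

A-basis : 3 ≤ k → IsMetricBasis (G k) (Alist k)
A-basis k≥3 = A-resolving , λ L (_ , resolving) →
  subst (_≤ length L) (sym length-Alist) (resolving-size k≥3 resolving)

theorem3p6 : (k : ℕ) → 3 ≤ k →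
    HasMetricDim (G k) k ×
    (IsMetricBasis (G k) (Alist k) ×
      (∀ L → IsMetricBasis (G k) L → ∀ v → (v ∈ L) ⇔ (v ∈ Alist k))) ×
    IsPairingResolving (G k) (NESubset k) b c
theorem3p6 k k≥3 =
  metric-dimension k≥3 ,
  (A-basis k≥3 , λ _ basis → basis-is-A k≥3 basis) ,
  pairing-resolving k≥3
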